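{- Let $1\le m\le n$ and $\pi\in\mathcal{S}_n$. Let $(C_1,\dots,C_{m-1})$ be a partial $\mathcal{K}$-interval parking function with outcome $\pi^{(m-1)}$, let $p=\pi_m^{ -1}$, and let $C_m$ be a non-empty subset of $[n]$. Then $(C_1,\dots,C_m)$ is a partial $\mathcal{K}$-interval parking function with outcome $\pi^{(m)}$ if and only if $C_m=\{r,r+1,\dots,r+k-1\}$ for some $k\in K_m$ and some integer $r$ with \[\max\{p-a_p(\pi)+1,\;p-k+1\}\le r\le\min\{p,\;n-k+1\}.\]
   Context: Let $[n]=\{1,\dots,n\}$, $\mathcal{S}_n$ the permutations of $[n]$ in one-line notation, and $\pi_i^{ -1}$ the position $j$ with $\pi_j=i$. Let $\mathcal{K}=(K_1,\dots,K_n)$ with $K_i\subseteq[n]$. For $0\le m\le n$, $S_{m,n}$ is the set of strings $\sigma_1\cdots\sigma_n$ over $\{1,\dots,m,*\}$ in which each of $1,\dots,m$ occurs exactly once and other letters are $*$; $\sigma_i^{ -1}$ is the index $j$ with $\sigma_j=i$. For $\pi\in\mathcal{S}_n$, $\pi^{(m)}\in S_{m,n}$ is obtained from $\pi$ by replacing every letter greater than $m$ by $*$. A tuple $(C_1,\dots,C_m)$ is a partial $\mathcal{K}$-interval parking function with outcome $\sigma\in S_{m,n}$ if for all $1\le i\le m$: $C_i$ is an interval of integers contained in $[n]$ with $|C_i|\in K_i$, and $\sigma_i^{ -1}$ is the smallest element of $C_i\setminus\{\sigma_{i'}^{ -1}:i'<i\}$. For $1\le i\le n$, $a_i(\pi)$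 is the largest $j$ with $1\le j\le i$ such that $\pi_i\ge\pi_{i'}$ for all $i-j+1\le i'\le i$. -}

module Defs where

open import Data.Nat using (ℕ; zero; suc; _+_; _≤_; _<_; _≤ᵇ_)
open import Data.Bool using (if_then_else_)
open import Data.Maybe using (Maybe; just; nothing)
open import Data.Product using (Σ; ∃; ∃-syntax; _×_)
open import Data.Sum using (_⊎_)
open import Data.Empty using (⊥)
open import Relation.Binary.PropositionalEquality using (_≡_)
open import Function.Bundles using (_⇔_)

-- Positions, letters, sizes are natural numbers, 1-indexed; [n] = {x | 1 ≤ x ≤ n}.
InRange : ℕ → ℕ → Set
InRange n x = 1 ≤ x × x ≤ n

-- π ∈ S_n : a function ℕ → ℕ whose restriction to [n] is a bijection [n] → [n]
-- (π i = π_i; values outside [n] are irrelevant).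
IsPerm : ℕ → (ℕ → ℕ) → Set
IsPerm n π =
  (∀ i → InRange n i → InRange n (π i)) ×
  (∀ i j → InRange n i → InRange n j → π i ≡ π j → i ≡ j)

-- A string σ₁⋯σₙ over {1,…,m,*}: σ j = just i means σ_j = i, nothing means *.
Str : Set
Str = ℕ → Maybe ℕ

IsPos : ℕ → Str → ℕ → ℕ → Set
IsPos n σ i j = InRange n j × σ j ≡ just i

InS : ℕ → ℕ → Str → Set
InS m n σ =
  (∀ j → InRange n j → (σ j ≡ nothing) ⊎ (Σ ℕ λ i → InRange m i × σ j ≡ just i)) ×
  (∀ i → InRange m i → ∃[ j ] IsPos n σ i j) ×
  (∀ i j j' → IsPos n σ i j → IsPos n σ i j' → j ≡ j')

restrict : (ℕ → ℕ) → ℕ → Str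
restrict π m j = if π j ≤ᵇ m then just (π j) else nothing

Subset : Set₁
Subset = ℕ → Set

IsIntervalOf : Subset → ℕ → ℕ → Set
IsIntervalOf C r k = ∀ x → C x ⇔ (r ≤ x × x < r + k)

-- C_i is an interval of integers contained in [n] with |C_i| ∈ K_i.
-- (An integer interval has size k iff it equals {r,…,r+k-1} for some r;
--  since elements lie in [n], r may be taken in ℕ when k ≥ 1, and for k = 0 any r works.)
GoodInterval : ℕ → (ℕ → Subset) → ℕ → Subset → Set
GoodInterval n K i C =
  (∀ x → C x → InRange n x) ×
  (∃[ r ] ∃[ k ] (IsIntervalOf C r k × K i k))

IsSmallestFree : ℕ → Str → ℕ → Subset → ℕ → Set
IsSmallestFree n σ i C j =
  (C j × ¬Taken j) × (∀ x → C x → ¬Taken x → j ≤ x)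
  where
  ¬Taken : ℕ → Set
  ¬Taken x = (i' : ℕ) → 1 ≤ i' → i' < i → IsPos n σ i' x → ⊥

PartialPF : ℕ → (ℕ → Subset) → ℕ → (ℕ → Subset) → Str → Set
PartialPF n K m C σ =
  InS m n σ ×
  (∀ i → InRange m i →
     GoodInterval n K i (C i) ×
     (∀ j → IsPos n σ i j → IsSmallestFree n σ i (C i) j))

ADom : (ℕ → ℕ) → ℕ → ℕ → Set
ADom π i j = ∀ i' → i < i' + j → i' ≤ i → π i' ≤ π i

IsA : (ℕ → ℕ) → ℕ → ℕ → Set
IsA π i j = InRange i j × ADom π i j × (∀ j' → InRange i j' → ADom π i j' → j' ≤ j)

module Submission where

--  * In π^{(M)} the letter of a position x is π_x when π_x ≤ M, so a position
--    x ∈ [n] is still free when letter i is parked (i ≤ M+1) exactly when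
--    π_x ≥ i.  Consequently the parking condition for a letter i ≤ M does not
--    depend on M, and the conditions for the letters 1,…,m-1 carry over from
--    the hypothesis; π^{(m)} ∈ S_{m,n} is also inherited from π^{(m-1)}.
--  * a_p(π) is characterised by: for r ≥ 1, the window [r, p] is dominated by
--    π_p iff p < r + a_p(π).
--  * For C = [r, r+k) ⊆ [n], p is the smallest free position of C at time m iff
--    r ≤ p < r + k and every x ∈ [r, p) is already taken, i.e. π_x < m = π_p;
--    by injectivity this says the window [r, p] is dominated by π_p, i.e.
--    p < r + a_p(π).

open import Defs
open import Data.Nat using (ℕ; _+_; _∸_; _≤_; suc)
open import Data.Product using (Σ; ∃; ∃-syntax; _×_)
open import Relation.Binary.PropositionalEquality using (_≡_)
open import Function.Bundles using (_⇔_)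

open import Data.Nat using (_<_; _≤ᵇ_; z≤n; s≤s; _≤?_)
open import Data.Nat.Properties
open import Data.Bool using (true; false; T)
open import Data.Unit using (tt)
open import Data.Maybe using (just; nothing)
open import Data.Product using (_,_; proj₁; proj₂)
open import Data.Sum using (_⊎_; inj₁; inj₂)
open import Data.Empty using (⊥; ⊥-elim)
open import Relation.Nullary using (yes; no)
open import Relation.Binary.PropositionalEquality using (refl; sym; trans; cong; subst; subst₂)
open import Function.Bundles using (mk⇔; Equivalence)

-- The statement writes p < q as p + 1 ≤ q.
<⇒+1≤ : ∀ {p q} → p < q → p + 1 ≤ q
<⇒+1≤ {p} {q} = subst (_≤ q) (+-comm 1 p)

+1≤⇒< : ∀ {p q} → p + 1 ≤ q → p < q
+1≤⇒< {p} {q} = subst (_≤ q) (+-comm p 1)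

InRange-suc : ∀ {M i} → InRange (suc M) i → InRange M i ⊎ i ≡ suc M
InRange-suc {M} {i} (1≤i , i≤M+1) with i ≤? M
... | yes i≤M = inj₁ (1≤i , i≤M)
... | no i≰M  = inj₂ (≤-antisym i≤M+1 (≰⇒> i≰M))

interval-end : ∀ {n C r k x} → IsIntervalOf C r k → (∀ y → C y → InRange n y) → C x → r + k ≤ n + 1
interval-end {n} {C} {r} {suc k'} interval C⊆[n] _ =
  subst₂ _≤_ (sym (+-suc r k')) (+-comm 1 n) (s≤s (proj₂ (C⊆[n] (r + k') last)))
  where
  last : C (r + k')
  last = Equivalence.from (interval (r + k')) (m≤m+n r k' , ≤-reflexive (sym (+-suc r k')))
interval-end {r = r} {k = 0} {x} interval _ Cx with Equivalence.to (interval x) Cx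
... | r≤x , x<r+0 = ⊥-elim (<⇒≱ (subst (x <_) (+-identityʳ r) x<r+0) r≤x)

Dominates : (ℕ → ℕ) → ℕ → ℕ → Set
Dominates π p r = ∀ x → r ≤ x → x ≤ p → π x ≤ π p

dominates⇒< : ∀ {π p a r} → IsA π p a → 1 ≤ r → r ≤ p → Dominates π p r → p < r + a
dominates⇒< {π} {p} {a} {r} (_ , _ , maximal) 1≤r r≤p dom =
  subst (_≤ r + a) (trans (+-suc r t) (cong suc r+t≡p)) (+-monoʳ-≤ r (maximal (suc t) t+1∈[p] adom))
  where
  t = p ∸ r
  r+t≡p : r + t ≡ p
  r+t≡p = m+[n∸m]≡n r≤p
  t+1∈[p] : InRange p (suc t)
  t+1∈[p] = s≤s z≤n , subst (suc t ≤_) r+t≡p (+-monoˡ-≤ t 1≤r)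
  adom : ADom π p (suc t)
  adom x p<x+t+1 x≤p = dom x (+-cancelʳ-≤ t r x r+t≤x+t) x≤p
    where
    r+t≤x+t : r + t ≤ x + t
    r+t≤x+t = subst (_≤ x + t) (sym r+t≡p) (≤-pred (subst (suc p ≤_) (+-suc x t) p<x+t+1))

-- Conversely, p < r + a_p(π) puts [r, p] inside the window (p - a_p, p] dominated by π_p.
<⇒dominates : ∀ {π p a r} → IsA π p a → p < r + a → Dominates π p r
<⇒dominates {a = a} (_ , adom , _) p<r+a x r≤x x≤p = adom x (≤-trans p<r+a (+-monoˡ-≤ a r≤x)) x≤p

Free : ℕ → Str → ℕ → ℕ → Set
Free n σ i x = (i' : ℕ) → 1 ≤ i' → i' < i → IsPos n σ i' x → ⊥

module Restriction (n : ℕ) (π : ℕ → ℕ) where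

  pos⇒ : ∀ M {i j} → IsPos n (restrict π M) i j → (π j ≡ i) × (i ≤ M)
  pos⇒ M {j = j} (_ , e) with π j ≤ᵇ M in eq
  pos⇒ M {j = j} (_ , refl) | true = refl , ≤ᵇ⇒≤ (π j) M (subst T (sym eq) tt)
  pos⇒ M         (_ , ())   | false

  pos⇐ : ∀ {M j} → InRange n j → π j ≤ M → IsPos n (restrict π M) (π j) j
  pos⇐ {M} {j} j∈[n] πj≤M with π j ≤ᵇ M in eq
  ... | true  = j∈[n] , refl
  ... | false = ⊥-elim (subst T eq (≤⇒≤ᵇ πj≤M))

  pos-transfer : ∀ M {M' i j} → i ≤ M' → IsPos n (restrict π M) i j → IsPos n (restrict π M') i j
  pos-transfer M i≤M' pos with pos⇒ M pos
  ... | refl , _ = pos⇐ (proj₁ pos) i≤M'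

  pos-unique : ∀ M {i j j'} → IsPerm n π →
    IsPos n (restrict π M) i j → IsPos n (restrict π M) i j' → j ≡ j'
  pos-unique M (_ , inj) pos pos' =
    inj _ _ (proj₁ pos) (proj₁ pos') (trans (proj₁ (pos⇒ M pos)) (sym (proj₁ (pos⇒ M pos'))))

  InS-suc : ∀ {M p} → IsPerm n π → InS M n (restrict π M) →
    IsPos n (restrict π (suc M)) (suc M) p → InS (suc M) n (restrict π (suc M))
  InS-suc {M} {p} perm@(range , _) (_ , occurs , _) posM+1 =
    letters , occurs' , λ _ _ _ → pos-unique (suc M) perm
    where
    letters : ∀ j → InRange n j →
      (restrict π (suc M) j ≡ nothing) ⊎ (Σ ℕ λ i → InRange (suc M) i × restrict π (suc M) j ≡ just i)
    letters j j∈[n] with π j ≤ᵇ suc M in eq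
    ... | true  = inj₂ (π j , (proj₁ (range j j∈[n]) , ≤ᵇ⇒≤ (π j) (suc M) (subst T (sym eq) tt)) , refl)
    ... | false = inj₁ refl
    occurs' : ∀ i → InRange (suc M) i → ∃[ j ] IsPos n (restrict π (suc M)) i j
    occurs' i i∈[M+1] with InRange-suc i∈[M+1]
    ... | inj₂ refl = p , posM+1
    ... | inj₁ i∈[M] with occurs i i∈[M]
    ...   | j , pos = j , pos-transfer M (m≤n⇒m≤1+n (proj₂ i∈[M])) pos

  ≤π⇒free : ∀ M {i x} → i ≤ π x → Free n (restrict π M) i x
  ≤π⇒free M i≤πx i' _ i'<i pos with pos⇒ M pos
  ... | refl , _ = <⇒≱ i'<i i≤πx

  free⇒≤π : ∀ M {i x} → IsPerm n π → InRange n x → i ≤ suc M →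
    Free n (restrict π M) i x → i ≤ π x
  free⇒≤π M {i} {x} (range , _) x∈[n] i≤M+1 free with i ≤? π x
  ... | yes i≤πx = i≤πx
  ... | no i≰πx  = ⊥-elim (free (π x) (proj₁ (range x x∈[n])) πx<i
                     (pos⇐ x∈[n] (≤-pred (≤-trans πx<i i≤M+1))))
    where πx<i = ≰⇒> i≰πx

  free-transfer : ∀ M M' {i x} → i ≤ suc M →
    Free n (restrict π M) i x → Free n (restrict π M') i x
  free-transfer M M' i≤M+1 free i' 1≤i' i'<i pos =
    free i' 1≤i' i'<i (pos-transfer M' (≤-pred (≤-trans i'<i i≤M+1)) pos)

  smallestFree-transfer : ∀ M M' {i C} → i ≤ M → i ≤ M' →
    (∀ j → IsPos n (restrict π M) i j → IsSmallestFree n (restrict π M) i C j) →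
    (∀ j → IsPos n (restrict π M') i j → IsSmallestFree n (restrict π M') i C j)
  smallestFree-transfer M M' i≤M i≤M' parked j pos
    with parked j (pos-transfer M' i≤M pos)
  ... | (Cj , free) , least =
    (Cj , free-transfer M M' (m≤n⇒m≤1+n i≤M) free) ,
    (λ x Cx freex → least x Cx (free-transfer M' M (m≤n⇒m≤1+n i≤M') freex))

  smallestFree⇔ : ∀ {M p a C r k} → IsPerm n π → InRange n p → π p ≡ M → IsA π p a →
    IsIntervalOf C r k → (∀ x → C x → InRange n x) →
    IsSmallestFree n (restrict π M) M C p ⇔ (r ≤ p × p < r + k × p < r + a)
  smallestFree⇔ {M} {p} {a} {C} {r} {k} perm@(_ , inj) p∈[n] πp≡M isA interval C⊆[n] =
    mk⇔ to from
    where
    M≤πp : M ≤ π p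
    M≤πp = ≤-reflexive (sym πp≡M)

    to : IsSmallestFree n (restrict π M) M C p → r ≤ p × p < r + k × p < r + a
    to ((Cp , _) , least) = r≤p , p<r+k , dominates⇒< isA 1≤r r≤p dom
      where
      r≤p : r ≤ p
      r≤p = proj₁ (Equivalence.to (interval p) Cp)
      p<r+k : p < r + k
      p<r+k = proj₂ (Equivalence.to (interval p) Cp)
      1≤r : 1 ≤ r
      1≤r = proj₁ (C⊆[n] r (Equivalence.from (interval r) (≤-refl , ≤-<-trans r≤p p<r+k)))
      -- A position of [r, p] carrying a letter ≥ M is free, hence not before p: it is p.
      dom : Dominates π p r
      dom x r≤x x≤p with M ≤? π x
      ... | yes M≤πx = ≤-reflexive (cong π (≤-antisym x≤p (least x Cx (≤π⇒free M M≤πx))))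
        where Cx = Equivalence.from (interval x) (r≤x , ≤-<-trans x≤p p<r+k)
      ... | no M≰πx = ≤-trans (<⇒≤ (≰⇒> M≰πx)) M≤πp

    from : r ≤ p × p < r + k × p < r + a → IsSmallestFree n (restrict π M) M C p
    from (r≤p , p<r+k , p<r+a) =
      (Equivalence.from (interval p) (r≤p , p<r+k) , ≤π⇒free M M≤πp) , least
      where
      -- A free x < p in C carries a letter ≤ π_p = M, hence < M, so it is taken.
      least : ∀ x → C x → Free n (restrict π M) M x → p ≤ x
      least x Cx free with p ≤? x
      ... | yes p≤x = p≤x
      ... | no p≰x  = ⊥-elim (<⇒≱ πx<M (free⇒≤π M perm x∈[n] (n≤1+n M) free))
        where
        x∈[n] = C⊆[n] x Cx
        x<p = ≰⇒> p≰x
        πx≤πp : π x ≤ π p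
        πx≤πp = <⇒dominates isA p<r+a x (proj₁ (Equivalence.to (interval x) Cx)) (<⇒≤ x<p)
        πx≢πp : π x ≡ π p → ⊥
        πx≢πp e = <⇒≢ x<p (inj x p x∈[n] p∈[n] e)
        πx<M : π x < M
        πx<M = subst (π x <_) πp≡M (≤∧≢⇒< πx≤πp πx≢πp)

lemma3p2 : (n m : ℕ) (K : ℕ → Subset) (π : ℕ → ℕ) (C : ℕ → Subset) (p a : ℕ) →
    (∀ i k → InRange n i → K i k → InRange n k) →
    1 ≤ m → m ≤ n → IsPerm n π →
    PartialPF n K (m ∸ 1) C (restrict π (m ∸ 1)) →
    InRange n p → π p ≡ m →
    IsA π p a →
    (∃[ x ] C m x) → (∀ x → C m x → InRange n x) →
    PartialPF n K m C (restrict π m) ⇔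
      (∃[ k ] ∃[ r ] (K m k × IsIntervalOf (C m) r k ×
        (p + 1 ≤ r + a) × (p + 1 ≤ r + k) × (r ≤ p) × (r + k ≤ n + 1)))
lemma3p2 n (suc m') K π C p a _ _ _ perm (InS-m' , parked-m') p∈[n] πp≡m isA _ Cm⊆[n] =
  mk⇔ to from
  where
  open Restriction n π
  m = suc m'
  posp : IsPos n (restrict π m) m p
  posp = subst (λ i → IsPos n (restrict π m) i p) πp≡m (pos⇐ p∈[n] (≤-reflexive πp≡m))

  Admissible : Set
  Admissible = ∃[ k ] ∃[ r ] (K m k × IsIntervalOf (C m) r k ×
    (p + 1 ≤ r + a) × (p + 1 ≤ r + k) × (r ≤ p) × (r + k ≤ n + 1))

  to : PartialPF n K m C (restrict π m) → Admissible
  to (_ , parked) with parked m (s≤s z≤n , ≤-refl)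
  ... | (_ , r , k , interval , Kk) , parked-m
    with Equivalence.to (smallestFree⇔ perm p∈[n] πp≡m isA interval Cm⊆[n]) (parked-m p posp)
  ... | r≤p , p<r+k , p<r+a =
    k , r , Kk , interval , <⇒+1≤ p<r+a , <⇒+1≤ p<r+k , r≤p ,
    interval-end interval Cm⊆[n] (Equivalence.from (interval p) (r≤p , p<r+k))

  from : Admissible → PartialPF n K m C (restrict π m)
  from (k , r , Kk , interval , p+1≤r+a , p+1≤r+k , r≤p , _) =
    InS-suc perm InS-m' posp , parked
    where
    parked-m : ∀ j → IsPos n (restrict π m) m j → IsSmallestFree n (restrict π m) m (C m) j
    parked-m j pos rewrite pos-unique m perm pos posp =
      Equivalence.from (smallestFree⇔ perm p∈[n] πp≡m isA interval Cm⊆[n])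
        (r≤p , +1≤⇒< p+1≤r+k , +1≤⇒< p+1≤r+a)
    parked : ∀ i → InRange m i → GoodInterval n K i (C i) ×
      (∀ j → IsPos n (restrict π m) i j → IsSmallestFree n (restrict π m) i (C i) j)
    parked i i∈[m] with InRange-suc i∈[m]
    ... | inj₂ refl = (Cm⊆[n] , r , k , interval , Kk) , parked-m
    ... | inj₁ i∈[m'] with parked-m' i i∈[m']
    ...   | good , parkedᵢ = good , smallestFree-transfer m' m (proj₂ i∈[m']) (m≤n⇒m≤1+n (proj₂ i∈[m'])) parkedᵢ
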